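{- Let $G$ be a connected $(P_5,\text{chair})$-free graph and let $C=v_1v_2v_3v_4v_5$ be an induced $C_5$ in $G$ (indices modulo 5). For $1\le i\le 5$ define, with all sets taken in $V(G)\setminus V(C)$: $S^1_3(i)=\{v: N_C(v)=\{v_{i-1},v_i,v_{i+1}\}\}$, $S^2_3(i)=\{v: N_C(v)=\{v_{i-2},v_i,v_{i+2}\}\}$, $S_4(i)=\{v: N_C(v)=\{v_{i-2},v_{i-1},v_{i+1},v_{i+2}\}\}$, $S_5=\{v: N_C(v)=V(C)\}$, and $R_i=S^1_3(i+1)\cup S^1_3(i-1)\cup S^2_3(i)\cup S_4(i+1)\cup S_4(i-1)\cup S_5$. Then for every $1\le i\le 5$, every vertex $s\in R_i$ and every two nonadjacent vertices $u,v\in S_4(i)$, the vertex $s$ is adjacent to at least one of $u,v$.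
   Context: Graphs are finite and simple. $P_5$ is the path on 5 vertices; a chair is a $P_4$ with an additional vertex adjacent to exactly one of the two middle vertices of the $P_4$. $G$ is $(P_5,\text{chair})$-free if it has no induced subgraph isomorphic to $P_5$ or to the chair. $N_C(v)=N(v)\cap V(C)$. -}

module Defs where

open import Data.Nat using (ℕ; _+_; _%_)
open import Data.Fin using (Fin; toℕ; fromℕ<)
open import Data.Nat.DivMod using (m%n<n)
open import Data.Product using (Σ; _×_; _,_)
open import Data.Sum using (_⊎_)
open import Data.List using (List; []; _∷_)
open import Data.List.Membership.Propositional using (_∈_)
open import Relation.Nullary using (¬_)
open import Relation.Binary using (Decidable)
open import Relation.Binary.PropositionalEquality using (_≡_; _≢_)
open import Relation.Binary.Construct.Closure.ReflexiveTransitive using (Star)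
open import Function.Definitions using (Injective)
open import Function.Bundles using (_⇔_)

record Graph (n : ℕ) : Set₁ where
  field
    Adj    : Fin n → Fin n → Set
    adj?   : Decidable Adj
    sym    : ∀ {x y} → Adj x y → Adj y x
    irrefl : ∀ {x} → ¬ Adj x x

open Graph public

Connected : ∀ {n} → Graph n → Set
Connected G = ∀ x y → Star (Adj G) x y

PEdge : ∀ {k} → List (ℕ × ℕ) → Fin k → Fin k → Set
PEdge es i j = ((toℕ i , toℕ j) ∈ es) ⊎ ((toℕ j , toℕ i) ∈ es)

IsInducedCopy : ∀ {n} → Graph n → (k : ℕ) → List (ℕ × ℕ) → (Fin k → Fin n) → Set
IsInducedCopy G k es f =
  Injective _≡_ _≡_ f × (∀ i j → Adj G (f i) (f j) ⇔ PEdge es i j)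

HasInduced : ∀ {n} → Graph n → (k : ℕ) → List (ℕ × ℕ) → Set
HasInduced {n} G k es = Σ (Fin k → Fin n) (IsInducedCopy G k es)

P5edges : List (ℕ × ℕ)
P5edges = (0 , 1) ∷ (1 , 2) ∷ (2 , 3) ∷ (3 , 4) ∷ []

ChairEdges : List (ℕ × ℕ)
ChairEdges = (0 , 1) ∷ (1 , 2) ∷ (2 , 3) ∷ (1 , 4) ∷ []

C5edges : List (ℕ × ℕ)
C5edges = (0 , 1) ∷ (1 , 2) ∷ (2 , 3) ∷ (3 , 4) ∷ (4 , 0) ∷ []

P5ChairFree : ∀ {n} → Graph n → Set
P5ChairFree G = ¬ HasInduced G 5 P5edges × ¬ HasInduced G 5 ChairEdges

-- index arithmetic modulo 5: i ⊕ m = i + m (mod 5); so i - 1 = i ⊕ 4, i - 2 = i ⊕ 3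
_⊕_ : Fin 5 → ℕ → Fin 5
i ⊕ m = fromℕ< (m%n<n (toℕ i + m) 5)

NCis : ∀ {n} → Graph n → (Fin 5 → Fin n) → Fin n → List (Fin 5) → Set
NCis G c v S = (∀ j → v ≢ c j) × (∀ j → Adj G v (c j) ⇔ (j ∈ S))

S13 S23 S4 : ∀ {n} → Graph n → (Fin 5 → Fin n) → Fin 5 → Fin n → Set
S13 G c i v = NCis G c v ((i ⊕ 4) ∷ i ∷ (i ⊕ 1) ∷ [])
S23 G c i v = NCis G c v ((i ⊕ 3) ∷ i ∷ (i ⊕ 2) ∷ [])
S4  G c i v = NCis G c v ((i ⊕ 3) ∷ (i ⊕ 4) ∷ (i ⊕ 1) ∷ (i ⊕ 2) ∷ [])

S5 : ∀ {n} → Graph n → (Fin 5 → Fin n) → Fin n → Set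
S5 G c v = NCis G c v (c0 ∷ c1 ∷ c2 ∷ c3 ∷ c4 ∷ [])
  where
  open import Data.Fin using (zero; suc)
  c0 c1 c2 c3 c4 : Fin 5
  c0 = zero
  c1 = suc zero
  c2 = suc (suc zero)
  c3 = suc (suc (suc zero))
  c4 = suc (suc (suc (suc zero)))

R : ∀ {n} → Graph n → (Fin 5 → Fin n) → Fin 5 → Fin n → Set
R G c i v =
  S13 G c (i ⊕ 1) v ⊎ S13 G c (i ⊕ 4) v ⊎ S23 G c i v ⊎
  S4 G c (i ⊕ 1) v ⊎ S4 G c (i ⊕ 4) v ⊎ S5 G c v

-- Take s ∈ R_i adjacent to neither of two nonadjacent u, v ∈ S_4(i). Every s ∈ R_i sees v_i, and
-- some v_k with k ≠ i sees exactly one end of the edge s v_i: a cycle-neighbour of v_i missed by s,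
-- or v_{i+2} when s ∈ S_5. As u and v see every v_k with k ≠ i but neither s nor v_i, the path
-- u - v_k - (the end seen by v_k) - (the other end), with v pendant at v_k, is an induced chair.
module Submission where

open import Defs
open import Data.Nat using (ℕ; _≤_; s≤s)
import Data.Nat as ℕ
open import Data.Nat.Properties using (_≤?_; ≰⇒>; <⇒≤)
open import Data.Fin using (Fin; zero; suc; toℕ; fromℕ)
open import Data.Fin.Properties using (_≟_; all?; any?)
open import Data.Product using (_×_; _,_; ∃-syntax)
open import Data.Product.Properties using (≡-dec)
open import Data.Sum using (_⊎_; inj₁; inj₂; swap)
open import Data.Empty using (⊥-elim)
open import Data.List using (List; []; _∷_)
open import Data.List.Membership.Propositional using (_∈_; _∉_)
open import Data.List.Relation.Unary.All as All using (All; lookup)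
open import Data.List.Relation.Unary.Any using (here; there)
import Data.List.Membership.DecPropositional as DecMembership
open import Function using (_∘_)
open import Function.Bundles using (_⇔_; mk⇔; Equivalence)
open import Relation.Binary using (Decidable)
open import Relation.Binary.PropositionalEquality as ≡ using (_≡_; _≢_; refl; subst)
open import Relation.Nullary using (¬_; Dec; yes; no)
open import Relation.Nullary.Decidable
  using (True; False; toWitness; toWitnessFalse; ¬?; _×-dec_; _⊎-dec_)

open Equivalence using (to; from)
open DecMembership {A = Fin 5} _≟_ using (_∈?_)

PEdge? : ∀ {k} (es : List (ℕ × ℕ)) → Decidable (PEdge {k} es)
PEdge? es i j = ((toℕ i , toℕ j) ∈ℕ²? es) ⊎-dec ((toℕ j , toℕ i) ∈ℕ²? es)
  where open DecMembership (≡-dec ℕ._≟_ ℕ._≟_) renaming (_∈?_ to _∈ℕ²?_)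

Separated : ∀ {k} → List (ℕ × ℕ) → Fin k → Fin k → Set
Separated es i j = ∃[ l ] PEdge es i l × ¬ PEdge es j l

separated? : ∀ {k} (es : List (ℕ × ℕ)) → Decidable (Separated {k} es)
separated? es i j = any? λ l → PEdge? es i l ×-dec ¬? (PEdge? es j l)

module _ {n k} (G : Graph n) (es : List (ℕ × ℕ)) (f : Fin k → Fin n) where

  Realises : Fin k → Fin k → Set
  Realises i j = Adj G (f i) (f j) ⇔ PEdge es i j

  realises-edge : ∀ {i j} {e : True (PEdge? es i j)} → Adj G (f i) (f j) → Realises i j
  realises-edge {e = e} a = mk⇔ (λ _ → toWitness e) (λ _ → a)

  realises-non-edge : ∀ {i j} {e : False (PEdge? es i j)} → ¬ Adj G (f i) (f j) → Realises i j
  realises-non-edge {e = e} ¬a = mk⇔ (⊥-elim ∘ ¬a) (⊥-elim ∘ toWitnessFalse e)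

  realises-sym : ∀ {i j} → Realises i j → Realises j i
  realises-sym r = mk⇔ (swap ∘ to r ∘ sym G) (sym G ∘ from r ∘ swap)

  separated⇒distinct : (∀ i j → Realises i j) → ∀ {i j} → Separated es i j → f i ≢ f j
  separated⇒distinct realises {i} {j} (l , il , ¬jl) fi≡fj =
    ¬jl (to (realises j l) (subst (λ x → Adj G x (f l)) fi≡fj (from (realises i l) il)))

-- The two leaves are the only twins of the chair, which is why induced-chair needs a ≢ e.
EqualOrLeavesOrSeparated : Fin 5 → Fin 5 → Set
EqualOrLeavesOrSeparated i j =
  i ≡ j ⊎ (i ≡ zero × j ≡ fromℕ 4) ⊎ (i ≡ fromℕ 4 × j ≡ zero) ⊎
  Separated ChairEdges i j ⊎ Separated ChairEdges j i

chair-pair-classified : ∀ i j → EqualOrLeavesOrSeparated i j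
chair-pair-classified = toWitness {a? = all? λ i → all? λ j →
  i ≟ j ⊎-dec (i ≟ zero ×-dec j ≟ fromℕ 4) ⊎-dec (i ≟ fromℕ 4 ×-dec j ≟ zero) ⊎-dec
  separated? ChairEdges i j ⊎-dec separated? ChairEdges j i} _

induced-chair : ∀ {n} (G : Graph n) {a b c d e} →
  Adj G a b → Adj G b c → Adj G c d → Adj G b e →
  ¬ Adj G a c → ¬ Adj G a d → ¬ Adj G a e → ¬ Adj G b d → ¬ Adj G c e → ¬ Adj G d e →
  a ≢ e → HasInduced G 5 ChairEdges
induced-chair {n} G {a} {b} {c} {d} {e} ab bc cd be ¬ac ¬ad ¬ae ¬bd ¬ce ¬de a≢e =
  f , injective , realises
  where
  f : Fin 5 → Fin n
  f zero = a
  f (suc zero) = b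
  f (suc (suc zero)) = c
  f (suc (suc (suc zero))) = d
  f (suc (suc (suc (suc zero)))) = e

  upward : ∀ i j → toℕ i ≤ toℕ j → Realises G ChairEdges f i j
  upward zero zero _ = realises-non-edge G ChairEdges f (irrefl G)
  upward zero (suc zero) _ = realises-edge G ChairEdges f ab
  upward zero (suc (suc zero)) _ = realises-non-edge G ChairEdges f ¬ac
  upward zero (suc (suc (suc zero))) _ = realises-non-edge G ChairEdges f ¬ad
  upward zero (suc (suc (suc (suc zero)))) _ = realises-non-edge G ChairEdges f ¬ae
  upward (suc zero) (suc zero) _ = realises-non-edge G ChairEdges f (irrefl G)
  upward (suc zero) (suc (suc zero)) _ = realises-edge G ChairEdges f bc
  upward (suc zero) (suc (suc (suc zero))) _ = realises-non-edge G ChairEdges f ¬bd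
  upward (suc zero) (suc (suc (suc (suc zero)))) _ = realises-edge G ChairEdges f be
  upward (suc (suc zero)) (suc (suc zero)) _ = realises-non-edge G ChairEdges f (irrefl G)
  upward (suc (suc zero)) (suc (suc (suc zero))) _ = realises-edge G ChairEdges f cd
  upward (suc (suc zero)) (suc (suc (suc (suc zero)))) _ = realises-non-edge G ChairEdges f ¬ce
  upward (suc (suc (suc zero))) (suc (suc (suc zero))) _ = realises-non-edge G ChairEdges f (irrefl G)
  upward (suc (suc (suc zero))) (suc (suc (suc (suc zero)))) _ = realises-non-edge G ChairEdges f ¬de
  upward (suc (suc (suc (suc zero)))) (suc (suc (suc (suc zero)))) _ =
    realises-non-edge G ChairEdges f (irrefl G)
  upward (suc _) zero ()
  upward (suc (suc _)) (suc zero) (s≤s ())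
  upward (suc (suc (suc _))) (suc (suc zero)) (s≤s (s≤s ()))
  upward (suc (suc (suc (suc _)))) (suc (suc (suc zero))) (s≤s (s≤s (s≤s ())))

  realises : ∀ i j → Realises G ChairEdges f i j
  realises i j with toℕ i ≤? toℕ j
  ... | yes i≤j = upward i j i≤j
  ... | no i≰j = realises-sym G ChairEdges f (upward j i (<⇒≤ (≰⇒> i≰j)))

  injective-by-cases : ∀ {i j} → EqualOrLeavesOrSeparated i j → f i ≡ f j → i ≡ j
  injective-by-cases (inj₁ i≡j) _ = i≡j
  injective-by-cases (inj₂ (inj₁ (refl , refl))) a≡e = ⊥-elim (a≢e a≡e)
  injective-by-cases (inj₂ (inj₂ (inj₁ (refl , refl)))) e≡a = ⊥-elim (a≢e (≡.sym e≡a))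
  injective-by-cases (inj₂ (inj₂ (inj₂ (inj₁ i|j)))) fi≡fj =
    ⊥-elim (separated⇒distinct G ChairEdges f realises i|j fi≡fj)
  injective-by-cases (inj₂ (inj₂ (inj₂ (inj₂ j|i)))) fi≡fj =
    ⊥-elim (separated⇒distinct G ChairEdges f realises j|i (≡.sym fi≡fj))

  injective : ∀ {i j} → f i ≡ f j → i ≡ j
  injective {i} {j} = injective-by-cases (chair-pair-classified i j)

N13 N23 N4 : Fin 5 → List (Fin 5)
N13 i = (i ⊕ 4) ∷ i ∷ (i ⊕ 1) ∷ []
N23 i = (i ⊕ 3) ∷ i ∷ (i ⊕ 2) ∷ []
N4 i = (i ⊕ 3) ∷ (i ⊕ 4) ∷ (i ⊕ 1) ∷ (i ⊕ 2) ∷ []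

N5 : List (Fin 5)
N5 = zero ∷ suc zero ∷ suc (suc zero) ∷ suc (suc (suc zero)) ∷ suc (suc (suc (suc zero))) ∷ []

-- v_k sees exactly one end of the edge between v_i and a vertex with neighbourhood S on C.
Splits : Fin 5 → List (Fin 5) → Fin 5 → Set
Splits i S k = (PEdge C5edges k i × k ∉ S) ⊎ (k ∈ S × ¬ PEdge C5edges k i)

Splittable : Fin 5 → List (Fin 5) → Set
Splittable i S = i ∈ S × ∃[ k ] k ∈ N4 i × Splits i S k

splittable? : ∀ i S → Dec (Splittable i S)
splittable? i S = i ∈? S ×-dec any? λ k → k ∈? N4 i ×-dec
  ((PEdge? C5edges k i ×-dec ¬? (k ∈? S)) ⊎-dec (k ∈? S ×-dec ¬? (PEdge? C5edges k i)))

R-neighbourhoods : Fin 5 → List (List (Fin 5))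
R-neighbourhoods i = N13 (i ⊕ 1) ∷ N13 (i ⊕ 4) ∷ N23 i ∷ N4 (i ⊕ 1) ∷ N4 (i ⊕ 4) ∷ N5 ∷ []

R-neighbourhoods-splittable : ∀ i → All (Splittable i) (R-neighbourhoods i)
R-neighbourhoods-splittable = toWitness {a? = all? λ i → All.all? (splittable? i) (R-neighbourhoods i)} _

centre∉N4 : ∀ i → i ∉ N4 i
centre∉N4 = toWitness {a? = all? λ i → ¬? (i ∈? N4 i)} _

module _ {n} (G : Graph n) (c : Fin 5 → Fin n) where

  NCis-sees : ∀ {x S j} → NCis G c x S → j ∈ S → Adj G x (c j)
  NCis-sees (_ , nbhd) j∈S = from (nbhd _) j∈S

  NCis-misses : ∀ {x S j} → NCis G c x S → j ∉ S → ¬ Adj G x (c j)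
  NCis-misses (_ , nbhd) j∉S = j∉S ∘ to (nbhd _)

  R⇒splittable : ∀ {i s} → R G c i s → ∃[ S ] NCis G c s S × Splittable i S
  R⇒splittable {i} (inj₁ r) = _ , r , lookup (R-neighbourhoods-splittable i) (here refl)
  R⇒splittable {i} (inj₂ (inj₁ r)) =
    _ , r , lookup (R-neighbourhoods-splittable i) (there (here refl))
  R⇒splittable {i} (inj₂ (inj₂ (inj₁ r))) =
    _ , r , lookup (R-neighbourhoods-splittable i) (there (there (here refl)))
  R⇒splittable {i} (inj₂ (inj₂ (inj₂ (inj₁ r)))) =
    _ , r , lookup (R-neighbourhoods-splittable i) (there (there (there (here refl))))
  R⇒splittable {i} (inj₂ (inj₂ (inj₂ (inj₂ (inj₁ r))))) =
    _ , r , lookup (R-neighbourhoods-splittable i) (there (there (there (there (here refl)))))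
  R⇒splittable {i} (inj₂ (inj₂ (inj₂ (inj₂ (inj₂ r))))) =
    _ , r , lookup (R-neighbourhoods-splittable i) (there (there (there (there (there (here refl))))))

  splittable⇒chair : (∀ i j → Adj G (c i) (c j) ⇔ PEdge C5edges i j) →
    ∀ {i s u v} → ∃[ S ] NCis G c s S × Splittable i S →
    S4 G c i u → S4 G c i v → u ≢ v → ¬ Adj G u v → ¬ Adj G s u → ¬ Adj G s v →
    HasInduced G 5 ChairEdges
  splittable⇒chair cycle {i} (_ , s∈ , i∈S , k , k∈N4 , inj₁ (ki , k∉S)) u∈ v∈ u≢v u≁v s≁u s≁v =
    induced-chair G (NCis-sees u∈ k∈N4) (from (cycle k i) ki) (sym G (NCis-sees s∈ i∈S))
      (sym G (NCis-sees v∈ k∈N4)) (NCis-misses u∈ (centre∉N4 i)) (s≁u ∘ sym G) u≁v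
      (NCis-misses s∈ k∉S ∘ sym G) (NCis-misses v∈ (centre∉N4 i) ∘ sym G) s≁v u≢v
  splittable⇒chair cycle {i} (_ , s∈ , i∈S , k , k∈N4 , inj₂ (k∈S , ¬ki)) u∈ v∈ u≢v u≁v s≁u s≁v =
    induced-chair G (NCis-sees u∈ k∈N4) (sym G (NCis-sees s∈ k∈S)) (NCis-sees s∈ i∈S)
      (sym G (NCis-sees v∈ k∈N4)) (s≁u ∘ sym G) (NCis-misses u∈ (centre∉N4 i)) u≁v
      (¬ki ∘ to (cycle k i)) s≁v (NCis-misses v∈ (centre∉N4 i) ∘ sym G) u≢v

claim9 : ∀ {n} (G : Graph n) → Connected G → P5ChairFree G →
         (c : Fin 5 → Fin n) → IsInducedCopy G 5 C5edges c →
         ∀ (i : Fin 5) (s u v : Fin n) → R G c i s →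
         S4 G c i u → S4 G c i v → u ≢ v → ¬ Adj G u v →
         Adj G s u ⊎ Adj G s v
claim9 G _ (_ , chair-free) c (_ , cycle) i s u v s∈R u∈ v∈ u≢v u≁v
  with adj? G s u | adj? G s v
... | yes s~u | _ = inj₁ s~u
... | no _ | yes s~v = inj₂ s~v
... | no s≁u | no s≁v = ⊥-elim (chair-free
  (splittable⇒chair G c cycle (R⇒splittable G c s∈R) u∈ v∈ u≢v u≁v s≁u s≁v))
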